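{- Let $A$ be a pseudo BCK-algebra and $\mu:A\to A$ a map. Then $(A,\mu)$ is a normal type II state pseudo BCK-algebra if and only if $(A,\mu)$ is a normal type I state pseudo BCK-algebra and ${\rm Ker}(\mu)$ is a commutative deductive system of $A$.
   Context: A pseudo BCK-algebra is an algebra $(A,\rightarrow,\rightsquigarrow,1)$ of type $(2,2,0)$ such that for all $x,y,z\in A$: $(x\rightarrow y)\rightsquigarrow[(y\rightarrow z)\rightsquigarrow(x\rightarrow z)]=1$; $(x\rightsquigarrow y)\rightarrow[(y\rightsquigarrow z)\rightarrow(x\rightsquigarrow z)]=1$; $1\rightarrow x=x$; $1\rightsquigarrow x=x$; $x\rightarrow 1=1$; and if $x\rightarrow y=1$ and $y\rightarrow x=1$ then $x=y$. The order is $x\le y$ iff $x\rightarrow y=1$ (iff $x\rightsquigarrow y=1$). A deductive system is a subset $D$ with $1\in D$ such that $x, x\rightarrow y\in D$ imply $y\in D$; it is normal if $x\rightarrow y\in D$ iff $x\rightsquigarrow y\in D$; it is commutative if $y\rightarrow x\in D$ implies $((x\rightarrow y)\rightsquigarrow y)\rightarrow x\in D$ and $y\rightsquigarrow x\in D$ implies $((x\rightsquigarrow y)\rightarrow y)\rightsquigarrow x\in D$. For $\mu:A\to A$ consider, for all $x,y\in A$: $(IS_1)$ $x\le y$ implies $\mu(x)\le\mu(y)$; $(IS_2)$ $\mu(x\rightarrow y)=\mu((x\rightarrow y)\rightsquigarrow y)\rightarrow\mu(y)$ and $\mu(x\rightsquigarrow y)=\mu((x\rightsquigarrow y)\rightarrow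 y)\rightsquigarrow\mu(y)$; $(IS_2')$ $\mu(x\rightarrow y)=\mu((y\rightarrow x)\rightsquigarrow x)\rightarrow\mu(y)$ and $\mu(x\rightsquigarrow y)=\mu((y\rightsquigarrow x)\rightarrow x)\rightsquigarrow\mu(y)$; $(IS_3)$ $\mu(\mu(x)\rightarrow\mu(y))=\mu(x)\rightarrow\mu(y)$ and $\mu(\mu(x)\rightsquigarrow\mu(y))=\mu(x)\rightsquigarrow\mu(y)$. $\mu$ is a type I state operator (and $(A,\mu)$ a type I state pseudo BCK-algebra) if it satisfies $(IS_1),(IS_2),(IS_3)$; type II if it satisfies $(IS_1),(IS_2'),(IS_3)$. ${\rm Ker}(\mu)=\{x\in A\mid \mu(x)=1\}$. A type I (type II) state operator is normal if ${\rm Ker}(\mu)$ is a normal deductive system. -}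

module Defs where

open import Level using (Level; suc; _⊔_)
open import Relation.Binary.PropositionalEquality using (_≡_)
open import Data.Product using (_×_)
open import Function.Bundles using (_⇔_)

record PseudoBCK (a : Level) : Set (suc a) where
  infixr 5 _⇒_ _⇝_
  field
    Carrier : Set a
    _⇒_     : Carrier → Carrier → Carrier
    _⇝_     : Carrier → Carrier → Carrier
    𝟏       : Carrier
    ax1     : ∀ x y z → ((x ⇒ y) ⇝ ((y ⇒ z) ⇝ (x ⇒ z))) ≡ 𝟏
    ax2     : ∀ x y z → ((x ⇝ y) ⇒ ((y ⇝ z) ⇒ (x ⇝ z))) ≡ 𝟏
    ax3     : ∀ x → (𝟏 ⇒ x) ≡ x
    ax4     : ∀ x → (𝟏 ⇝ x) ≡ x
    ax5     : ∀ x → (x ⇒ 𝟏) ≡ 𝟏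
    ax6     : ∀ x y → (x ⇒ y) ≡ 𝟏 → (y ⇒ x) ≡ 𝟏 → x ≡ y

  _≤_ : Carrier → Carrier → Set a
  x ≤ y = (x ⇒ y) ≡ 𝟏

module _ {a : Level} (A : PseudoBCK a) where
  open PseudoBCK A

  Subset : Set (suc a)
  Subset = Carrier → Set a

  record IsDeductiveSystem (D : Subset) : Set a where
    field
      one∈ : D 𝟏
      mp   : ∀ x y → D x → D (x ⇒ y) → D y

  IsNormalDS : Subset → Set a
  IsNormalDS D = IsDeductiveSystem D × (∀ x y → D (x ⇒ y) ⇔ D (x ⇝ y))

  IsCommutativeDS : Subset → Set a
  IsCommutativeDS D =
    IsDeductiveSystem D ×
    ((∀ x y → D (y ⇒ x) → D (((x ⇒ y) ⇝ y) ⇒ x)) ×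
     (∀ x y → D (y ⇝ x) → D (((x ⇝ y) ⇒ y) ⇝ x)))

  Ker : (Carrier → Carrier) → Subset
  Ker μ x = μ x ≡ 𝟏

  IS1 : (Carrier → Carrier) → Set a
  IS1 μ = ∀ x y → x ≤ y → μ x ≤ μ y

  IS2 : (Carrier → Carrier) → Set a
  IS2 μ = ∀ x y →
    (μ (x ⇒ y) ≡ (μ ((x ⇒ y) ⇝ y) ⇒ μ y)) ×
    (μ (x ⇝ y) ≡ (μ ((x ⇝ y) ⇒ y) ⇝ μ y))

  IS2′ : (Carrier → Carrier) → Set a
  IS2′ μ = ∀ x y →
    (μ (x ⇒ y) ≡ (μ ((y ⇒ x) ⇝ x) ⇒ μ y)) ×
    (μ (x ⇝ y) ≡ (μ ((y ⇝ x) ⇒ x) ⇝ μ y))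

  IS3 : (Carrier → Carrier) → Set a
  IS3 μ = ∀ x y →
    (μ (μ x ⇒ μ y) ≡ (μ x ⇒ μ y)) ×
    (μ (μ x ⇝ μ y) ≡ (μ x ⇝ μ y))

  IsTypeIStateOperator : (Carrier → Carrier) → Set a
  IsTypeIStateOperator μ = IS1 μ × IS2 μ × IS3 μ

  IsTypeIIStateOperator : (Carrier → Carrier) → Set a
  IsTypeIIStateOperator μ = IS1 μ × IS2′ μ × IS3 μ

  IsNormalTypeIStateOperator : (Carrier → Carrier) → Set a
  IsNormalTypeIStateOperator μ = IsTypeIStateOperator μ × IsNormalDS (Ker μ)

  IsNormalTypeIIStateOperator : (Carrier → Carrier) → Set a
  IsNormalTypeIIStateOperator μ = IsTypeIIStateOperator μ × IsNormalDS (Ker μ)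

-- Swapping the two implications of a pseudo BCK-algebra gives again a pseudo
-- BCK-algebra, and every condition of the theorem splits into a ⇒-half and a
-- ⇝-half exchanged by this swap, so it suffices to treat the ⇒-halves.
-- Since ((x ⇒ y) ⇝ y) ⇒ y = x ⇒ y, condition (IS2′) yields μ(a ⇒ b) = μa ⇒ μb
-- for b ≤ a, which gives both (IS2) and commutativity of Ker μ. Conversely, (IS2)
-- turns a ⇒ b ∈ Ker μ into μa ≤ μb, and commutativity of Ker μ puts
-- ((x ⇒ y) ⇝ y) ⇒ ((y ⇒ x) ⇝ x) into Ker μ; by symmetry
-- μ((x ⇒ y) ⇝ y) = μ((y ⇒ x) ⇝ x), so (IS2) and (IS2′) coincide.
module Submission where

open import Defs
open import Level using (Level)
open import Data.Product using (_×_; _,_; proj₁; proj₂)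
open import Function.Base using (_∘₂_)
open import Function.Bundles using (_⇔_; mk⇔)
open import Relation.Binary.PropositionalEquality
open ≡-Reasoning

module _ {a : Level} (A : PseudoBCK a) where
  open PseudoBCK A

  𝟏⇒-elim : ∀ {u} → 𝟏 ⇒ u ≡ 𝟏 → u ≡ 𝟏
  𝟏⇒-elim {u} = trans (sym (ax3 u))

  𝟏⇝-elim : ∀ {u} → 𝟏 ⇝ u ≡ 𝟏 → u ≡ 𝟏
  𝟏⇝-elim {u} = trans (sym (ax4 u))

  x⇝[x⇒y]⇝y≡𝟏 : ∀ x y → x ⇝ ((x ⇒ y) ⇝ y) ≡ 𝟏
  x⇝[x⇒y]⇝y≡𝟏 x y = subst₂ (λ u v → u ⇝ ((x ⇒ y) ⇝ v) ≡ 𝟏) (ax3 x) (ax3 y) (ax1 𝟏 x y)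

  x≤[x⇝y]⇒y : ∀ x y → x ≤ ((x ⇝ y) ⇒ y)
  x≤[x⇝y]⇒y x y = subst₂ (λ u v → u ⇒ ((x ⇝ y) ⇒ v) ≡ 𝟏) (ax4 x) (ax4 y) (ax2 𝟏 x y)

  ⇒≡𝟏→⇝≡𝟏 : ∀ {x y} → x ⇒ y ≡ 𝟏 → x ⇝ y ≡ 𝟏
  ⇒≡𝟏→⇝≡𝟏 {x} {y} h =
    subst (λ v → x ⇝ v ≡ 𝟏) (ax4 y) (subst (λ u → x ⇝ (u ⇝ y) ≡ 𝟏) h (x⇝[x⇒y]⇝y≡𝟏 x y))

  ⇝≡𝟏→⇒≡𝟏 : ∀ {x y} → x ⇝ y ≡ 𝟏 → x ⇒ y ≡ 𝟏
  ⇝≡𝟏→⇒≡𝟏 {x} {y} h =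
    subst (λ v → x ⇒ v ≡ 𝟏) (ax3 y) (subst (λ u → x ⇒ (u ⇒ y) ≡ 𝟏) h (x≤[x⇝y]⇒y x y))

  x⇝𝟏≡𝟏 : ∀ x → x ⇝ 𝟏 ≡ 𝟏
  x⇝𝟏≡𝟏 x = ⇒≡𝟏→⇝≡𝟏 (ax5 x)

  x≤[x⇒y]⇝y : ∀ x y → x ≤ ((x ⇒ y) ⇝ y)
  x≤[x⇒y]⇝y x y = ⇝≡𝟏→⇒≡𝟏 (x⇝[x⇒y]⇝y≡𝟏 x y)

  y≤x⇝y : ∀ x y → y ≤ (x ⇝ y)
  y≤x⇝y x y = 𝟏⇒-elim (subst₂ (λ u v → u ⇒ (v ⇒ (x ⇝ y)) ≡ 𝟏) (x⇝𝟏≡𝟏 x) (ax4 y) (ax2 x 𝟏 y))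

  ≤-trans : ∀ {x y z} → x ≤ y → y ≤ z → x ≤ z
  ≤-trans {x} {y} {z} x≤y y≤z =
    𝟏⇝-elim (𝟏⇝-elim (subst₂ (λ u v → u ⇝ (v ⇝ (x ⇒ z)) ≡ 𝟏) x≤y y≤z (ax1 x y z)))

  ⇒-antitoneˡ : ∀ {x y} z → x ≤ y → (y ⇒ z) ≤ (x ⇒ z)
  ⇒-antitoneˡ {x} {y} z x≤y =
    ⇝≡𝟏→⇒≡𝟏 (𝟏⇝-elim (subst (λ u → u ⇝ ((y ⇒ z) ⇝ (x ⇒ z)) ≡ 𝟏) x≤y (ax1 x y z)))

  ⇝-antitoneˡ : ∀ {x y} z → x ≤ y → (y ⇝ z) ≤ (x ⇝ z)
  ⇝-antitoneˡ {x} {y} z x≤y =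
    𝟏⇒-elim (subst (λ u → u ⇒ ((y ⇝ z) ⇒ (x ⇝ z)) ≡ 𝟏) (⇒≡𝟏→⇝≡𝟏 x≤y) (ax2 x y z))

  [[x⇒y]⇝y]⇒y≡x⇒y : ∀ x y → ((x ⇒ y) ⇝ y) ⇒ y ≡ x ⇒ y
  [[x⇒y]⇝y]⇒y≡x⇒y x y = ax6 _ _ (⇒-antitoneˡ y (x≤[x⇒y]⇝y x y)) (x≤[x⇝y]⇒y (x ⇒ y) y)

opposite : ∀ {a} → PseudoBCK a → PseudoBCK a
opposite A = record
  { Carrier = Carrier
  ; _⇒_     = _⇝_
  ; _⇝_     = _⇒_
  ; 𝟏       = 𝟏
  ; ax1     = ax2
  ; ax2     = ax1
  ; ax3     = ax4
  ; ax4     = ax3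
  ; ax5     = x⇝𝟏≡𝟏 A
  ; ax6     = λ x y x⇝y≡𝟏 y⇝x≡𝟏 → ax6 x y (⇝≡𝟏→⇒≡𝟏 A x⇝y≡𝟏) (⇝≡𝟏→⇒≡𝟏 A y⇝x≡𝟏)
  }
  where open PseudoBCK A

module _ {a : Level} (A : PseudoBCK a) (μ : PseudoBCK.Carrier A → PseudoBCK.Carrier A) where
  open PseudoBCK A

  IS1-opposite : IS1 A μ → IS1 (opposite A) μ
  IS1-opposite is1 x y x⇝y≡𝟏 = ⇒≡𝟏→⇝≡𝟏 A (is1 x y (⇝≡𝟏→⇒≡𝟏 A x⇝y≡𝟏))

  IS2⇒ : Set a
  IS2⇒ = ∀ x y → μ (x ⇒ y) ≡ μ ((x ⇒ y) ⇝ y) ⇒ μ y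

  IS2′⇒ : Set a
  IS2′⇒ = ∀ x y → μ (x ⇒ y) ≡ μ ((y ⇒ x) ⇝ x) ⇒ μ y

  Commutative⇒ : Subset A → Set a
  Commutative⇒ D = ∀ x y → D (y ⇒ x) → D (((x ⇒ y) ⇝ y) ⇒ x)

  module _ (is2′ : IS2′⇒) where

    IS2′⇒-homomorphic-≥ : ∀ {x y} → y ≤ x → μ (x ⇒ y) ≡ μ x ⇒ μ y
    IS2′⇒-homomorphic-≥ {x} {y} y≤x = begin
      μ (x ⇒ y)                ≡⟨ is2′ x y ⟩
      μ ((y ⇒ x) ⇝ x) ⇒ μ y    ≡⟨ cong (λ u → μ (u ⇝ x) ⇒ μ y) y≤x ⟩
      μ (𝟏 ⇝ x) ⇒ μ y          ≡⟨ cong (λ u → μ u ⇒ μ y) (ax4 x) ⟩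
      μ x ⇒ μ y                ∎

    IS2′⇒→IS2⇒ : IS2⇒
    IS2′⇒→IS2⇒ x y = begin
      μ (x ⇒ y)                ≡⟨ cong μ (sym ([[x⇒y]⇝y]⇒y≡x⇒y A x y)) ⟩
      μ (((x ⇒ y) ⇝ y) ⇒ y)    ≡⟨ IS2′⇒-homomorphic-≥ (y≤x⇝y A (x ⇒ y) y) ⟩
      μ ((x ⇒ y) ⇝ y) ⇒ μ y    ∎

    IS2′⇒→Commutative⇒ : Commutative⇒ (Ker A μ)
    IS2′⇒→Commutative⇒ x y μ[y⇒x]≡𝟏 = begin
      μ (((x ⇒ y) ⇝ y) ⇒ x)    ≡⟨ IS2′⇒-homomorphic-≥ (x≤[x⇒y]⇝y A x y) ⟩
      μ ((x ⇒ y) ⇝ y) ⇒ μ x    ≡⟨ sym (is2′ y x) ⟩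
      μ (y ⇒ x)                ≡⟨ μ[y⇒x]≡𝟏 ⟩
      𝟏                        ∎

  module _ (is1 : IS1 A μ) (is2 : IS2⇒) where

    Ker-upward-closed : ∀ {x y} → μ x ≡ 𝟏 → x ≤ y → μ y ≡ 𝟏
    Ker-upward-closed {x} {y} μx≡𝟏 x≤y =
      𝟏⇒-elim A (subst (λ u → u ⇒ μ y ≡ 𝟏) μx≡𝟏 (is1 x y x≤y))

    Ker-⇒→μ-≤ : ∀ {x y} → μ (x ⇒ y) ≡ 𝟏 → μ x ≤ μ y
    Ker-⇒→μ-≤ {x} {y} μ[x⇒y]≡𝟏 =
      ≤-trans A (is1 _ _ (x≤[x⇒y]⇝y A x y)) (trans (sym (is2 x y)) μ[x⇒y]≡𝟏)

    module _ (μ𝟏≡𝟏 : μ 𝟏 ≡ 𝟏) (comm : Commutative⇒ (Ker A μ)) where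

      μ[x⇒y]⇝y≤μ[y⇒x]⇝x : ∀ x y → μ ((x ⇒ y) ⇝ y) ≤ μ ((y ⇒ x) ⇝ x)
      μ[x⇒y]⇝y≤μ[y⇒x]⇝x x y =
        Ker-⇒→μ-≤ (Ker-upward-closed (comm v y μ[y⇒v]≡𝟏) [[v⇒y]⇝y]⇒v≤[[x⇒y]⇝y]⇒v)
        where
        v : Carrier
        v = (y ⇒ x) ⇝ x
        μ[y⇒v]≡𝟏 : μ (y ⇒ v) ≡ 𝟏
        μ[y⇒v]≡𝟏 = trans (cong μ (x≤[x⇒y]⇝y A y x)) μ𝟏≡𝟏
        [[v⇒y]⇝y]⇒v≤[[x⇒y]⇝y]⇒v : (((v ⇒ y) ⇝ y) ⇒ v) ≤ (((x ⇒ y) ⇝ y) ⇒ v)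
        [[v⇒y]⇝y]⇒v≤[[x⇒y]⇝y]⇒v =
          ⇒-antitoneˡ A v (⇝-antitoneˡ A y (⇒-antitoneˡ A y (y≤x⇝y A (y ⇒ x) x)))

      IS2⇒→IS2′⇒ : IS2′⇒
      IS2⇒→IS2′⇒ x y = trans (is2 x y)
        (cong (_⇒ μ y) (ax6 _ _ (μ[x⇒y]⇝y≤μ[y⇒x]⇝x x y) (μ[x⇒y]⇝y≤μ[y⇒x]⇝x y x)))

theorem5p15 : {a : Level} (A : PseudoBCK a) (μ : PseudoBCK.Carrier A → PseudoBCK.Carrier A) →
    IsNormalTypeIIStateOperator A μ ⇔
      (IsNormalTypeIStateOperator A μ × IsCommutativeDS A (Ker A μ))
theorem5p15 {a} A μ = mk⇔ to from
  where
  open PseudoBCK A using (𝟏)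

  Aᵒᵖ : PseudoBCK a
  Aᵒᵖ = opposite A

  to : IsNormalTypeIIStateOperator A μ →
       IsNormalTypeIStateOperator A μ × IsCommutativeDS A (Ker A μ)
  to ((is1 , is2′ , is3) , normal) =
    ((is1 , is2 , is3) , normal) ,
    proj₁ normal , IS2′⇒→Commutative⇒ A μ (proj₁ ∘₂ is2′) , IS2′⇒→Commutative⇒ Aᵒᵖ μ (proj₂ ∘₂ is2′)
    where
    is2 : IS2 A μ
    is2 x y = IS2′⇒→IS2⇒ A μ (proj₁ ∘₂ is2′) x y , IS2′⇒→IS2⇒ Aᵒᵖ μ (proj₂ ∘₂ is2′) x y

  from : IsNormalTypeIStateOperator A μ × IsCommutativeDS A (Ker A μ) →
         IsNormalTypeIIStateOperator A μ
  from (((is1 , is2 , is3) , normal) , ds , comm , commᵒᵖ) = (is1 , is2′ , is3) , normal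
    where
    μ𝟏≡𝟏 : μ 𝟏 ≡ 𝟏
    μ𝟏≡𝟏 = IsDeductiveSystem.one∈ ds
    is2′ : IS2′ A μ
    is2′ x y = IS2⇒→IS2′⇒ A μ is1 (proj₁ ∘₂ is2) μ𝟏≡𝟏 comm x y
             , IS2⇒→IS2′⇒ Aᵒᵖ μ (IS1-opposite A μ is1) (proj₂ ∘₂ is2) μ𝟏≡𝟏 commᵒᵖ x y
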